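{- For all integers $s\ge2$ and $m\ge s+1$, the tight cycle $C_m^{(s)}$ is edge-balanced.
   Context: The tight cycle $C_m^{(s)}$ is the $s$-graph with $m$ vertices in cyclic order whose $m$ edges are the sets of $s$ cyclically consecutive vertices. For an $s$-graph $F$ with $v_F$ vertices and $e_F$ edges, $g(F)=1/s$ if $e_F=1$ and $g(F)=\frac{e_F-1}{v_F-s}$ if $e_F>1$; $F$ is edge-balanced if every sub-$s$-graph $F'\subseteq F$ with $e_{F'}>0$ satisfies $g(F')\le g(F)$. -}

module Defs where

open import Data.Nat using (ℕ; zero; suc; _∸_; _+_; _≤ᵇ_; _<ᵇ_)
open import Data.Integer using (+_)
open import Data.Rational using (ℚ; _/_; _≤_) renaming (0ℚ to 0q)
open import Data.Fin using (Fin; toℕ)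
open import Data.Fin.Subset using (Subset; ∣_∣; _⊆_; _∈_)
open import Data.Vec using (tabulate)
open import Data.Bool using (if_then_else_)
open import Data.Nat using (_<_)

record SGraph : Set where
  field
    nV   : ℕ
    nE   : ℕ
    edge : Fin nE → Subset nV
open SGraph public

-- The density g(F) as a function of s, v_F, e_F:
--   g = 1/s            if e_F = 1
--   g = (e_F-1)/(v_F-s) if e_F > 1
-- (junk value 0 only in the degenerate cases s = 0, resp. v_F ≤ s, which
-- never occur for e_F > 1 and s ≥ 1 in an s-graph).
g : ℕ → ℕ → ℕ → ℚ
g zero    v (suc zero) = 0q
g (suc t) v (suc zero) = + 1 / suc t
g s v e with v ∸ s
... | zero  = 0q
... | suc d = + (e ∸ 1) / suc d

IsSub : (F : SGraph) → Subset (nV F) → Subset (nE F) → Set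
IsSub F V' E' = ∀ i → i ∈ E' → edge F i ⊆ V'

EdgeBalanced : ℕ → SGraph → Set
EdgeBalanced s F =
  ∀ (V' : Subset (nV F)) (E' : Subset (nE F)) → IsSub F V' E' → 0 < ∣ E' ∣ →
  g s ∣ V' ∣ ∣ E' ∣ ≤ g s (nV F) (nE F)

cdist : (m : ℕ) → Fin m → Fin m → ℕ
cdist m i j = if toℕ i ≤ᵇ toℕ j then toℕ j ∸ toℕ i else (m + toℕ j) ∸ toℕ i

-- Tight cycle C_m^(s): vertices Fin m in cyclic order, edge i =
-- {i, i+1, ..., i+s-1} (mod m), for i ∈ Fin m.
TightCycle : (s m : ℕ) → SGraph
TightCycle s m = record
  { nV = m
  ; nE = m
  ; edge = λ i → tabulate (λ j → cdist m i j <ᵇ s)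
  }

-- The density of C_m^(s) is (m-1)/(m-s) ≥ 1.  A sub-s-graph F′ spanning every
-- vertex has density (e′-1)/(m-s) ≤ (m-1)/(m-s).  Otherwise F′ misses a vertex u,
-- which no edge of F′ passes through: read from just after u, the cycle becomes a
-- path on which the edges of F′ are intervals of s vertices, and the s-1 vertices
-- after the last interval start no edge, so v′ ≥ e′ + s - 1 and g(F′) ≤ 1.
module Submission where

open import Defs
open import Data.Nat using (ℕ; _≤_; suc; zero; _+_; _∸_; _*_; _<_; _%_; _<ᵇ_; NonZero; z≤n; s≤s; _<?_; _≤?_)
open import Data.Nat.Properties
open import Data.Nat.DivMod using (_mod_; m<n⇒m%n≡m; [m+n]%n≡m%n; %-distribˡ-+; m%n<n)
open import Data.Bool using (Bool; true; false; if_then_else_)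
open import Data.Bool.Properties using (T-≡)
open import Data.Product using (∃; _×_; _,_; proj₁; proj₂)
open import Function.Bundles using (Equivalence)
open import Relation.Nullary using (yes; no; contradiction)
open import Relation.Nullary.Decidable using (dec-true; dec-false)
open import Relation.Binary.PropositionalEquality
open import Data.Fin as Fin using (Fin; toℕ)
open import Data.Fin.Properties using (toℕ-fromℕ<; toℕ-injective; toℕ<n; all?; ¬∀⟶∃¬)
open import Data.Vec using ([]; _∷_; lookup; tabulate)
open import Data.Vec.Properties using (lookup∘tabulate; lookup⇒[]=; []=⇒lookup)
open import Data.Fin.Subset using (Subset; ⊤; ∣_∣; _∈_; _∉_)
open import Data.Fin.Subset.Properties using (∣p∣≤n; _∈?_; p⊆q⇒∣p∣≤∣q∣; ∣⊤∣≡n)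
import Data.Integer as ℤ
import Data.Integer.Properties as ℤ
open import Data.Rational as ℚ using (_/_; 1ℚ)
import Data.Rational.Properties as ℚ
import Data.Rational.Unnormalised as ℚᵘ
import Data.Rational.Unnormalised.Properties as ℚᵘ

open Equivalence using (to)

bit : Bool → ℕ
bit b = if b then 1 else 0

count : ℕ → (ℕ → Bool) → ℕ
count zero    f = 0
count (suc n) f = count n f + bit (f n)

count-cong : ∀ n {f h : ℕ → Bool} → (∀ k → k < n → f k ≡ h k) → count n f ≡ count n h
count-cong zero    f≡h = refl
count-cong (suc n) f≡h =
  cong₂ _+_ (count-cong n (λ k k<n → f≡h k (m<n⇒m<1+n k<n))) (cong bit (f≡h n ≤-refl))

count-+ : ∀ a b f → count (a + b) f ≡ count a f + count b (λ k → f (a + k))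
count-+ a zero    f = trans (cong (λ n → count n f) (+-identityʳ a)) (sym (+-identityʳ _))
count-+ a (suc b) f = begin
  count (a + suc b) f                                     ≡⟨ cong (λ n → count n f) (+-suc a b) ⟩
  count (a + b) f + bit (f (a + b))                       ≡⟨ cong (_+ bit (f (a + b))) (count-+ a b f) ⟩
  count a f + count b (λ k → f (a + k)) + bit (f (a + b)) ≡⟨ +-assoc (count a f) _ _ ⟩
  count a f + count (suc b) (λ k → f (a + k))             ∎
  where open ≡-Reasoning

count-monoˡ-≤ : ∀ {a b} f → a ≤ b → count a f ≤ count b f
count-monoˡ-≤ {a} {b} f a≤b = begin
  count a f                                   ≤⟨ m≤m+n _ _ ⟩
  count a f + count (b ∸ a) (λ k → f (a + k)) ≡⟨ count-+ a (b ∸ a) f ⟨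
  count (a + (b ∸ a)) f                       ≡⟨ cong (λ n → count n f) (m+[n∸m]≡n a≤b) ⟩
  count b f                                   ∎
  where open ≤-Reasoning

count-mono : ∀ n {E V : ℕ → Bool} → (∀ k → k < n → E k ≡ true → V k ≡ true) → count n E ≤ count n V
count-mono zero    E⇒V = z≤n
count-mono (suc n) {E} {V} E⇒V = +-mono-≤ (count-mono n (λ k k<n → E⇒V k (m<n⇒m<1+n k<n))) (bit-mono (E n) (V n) (E⇒V n ≤-refl))
  where
  bit-mono : ∀ x y → (x ≡ true → y ≡ true) → bit x ≤ bit y
  bit-mono false y _   = z≤n
  bit-mono true  y x⇒y rewrite x⇒y refl = ≤-refl

count-all : ∀ n f → (∀ k → k < n → f k ≡ true) → count n f ≡ n
count-all zero    f all = refl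
count-all (suc n) f all rewrite all n ≤-refl | count-all n f (λ k k<n → all k (m<n⇒m<1+n k<n)) = +-comm n 1

count-last : ∀ n E → 0 < count n E → ∃ λ p → p < n × E p ≡ true × count n E ≡ count (suc p) E
count-last zero    E ()
count-last (suc n) E pos with E n in En
... | true  = n , ≤-refl , En , cong (λ b → count n E + bit b) (sym En)
... | false with count-last n E (subst (0 <_) (+-identityʳ _) pos)
...   | p , p<n , Ep , eq = p , m<n⇒m<1+n p<n , Ep , trans (+-identityʳ _) eq

count-intervals : ∀ n s₁ (E V : ℕ → Bool) →
  (∀ k → k < n → E k ≡ true → ∀ j → j ≤ s₁ → k + j < n × V (k + j) ≡ true) →
  0 < count n E → count n E + s₁ ≤ count n V
count-intervals n s₁ E V intervals pos with count-last n E pos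
... | p , p<n , Ep , last = begin
  count n E + s₁                                   ≡⟨ cong (_+ s₁) last ⟩
  count (suc p) E + s₁                             ≤⟨ +-monoˡ-≤ s₁ (count-mono (suc p) E⇒V) ⟩
  count (suc p) V + s₁                             ≡⟨ cong (count (suc p) V +_) (count-all s₁ _ after-p) ⟨
  count (suc p) V + count s₁ (λ k → V (suc p + k)) ≡⟨ count-+ (suc p) s₁ V ⟨
  count (suc p + s₁) V                             ≤⟨ count-monoˡ-≤ V (interval-of-p s₁ ≤-refl .proj₁) ⟩
  count n V                                        ∎
  where
  open ≤-Reasoning
  interval-of-p : ∀ j → j ≤ s₁ → p + j < n × V (p + j) ≡ true
  interval-of-p = intervals p p<n Ep
  E⇒V : ∀ k → k < suc p → E k ≡ true → V k ≡ true
  E⇒V k k≤p Ek = subst (λ i → V i ≡ true) (+-identityʳ k) (intervals k (≤-<-trans (≤-pred k≤p) p<n) Ek 0 z≤n .proj₂)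
  after-p : ∀ j → j < s₁ → V (suc p + j) ≡ true
  after-p j j<s₁ = subst (λ i → V i ≡ true) (+-suc p j) (interval-of-p (suc j) j<s₁ .proj₂)

count-shift : ∀ n h → h n ≡ h 0 → count n (λ k → h (suc k)) ≡ count n h
count-shift n h hn≡h0 = +-cancelˡ-≡ (bit (h 0)) _ _ (begin
  bit (h 0) + count n (λ k → h (suc k)) ≡⟨ count-+ 1 n h ⟨
  count (suc n) h                       ≡⟨ cong (λ b → count n h + bit b) hn≡h0 ⟩
  count n h + bit (h 0)                 ≡⟨ +-comm (count n h) _ ⟩
  bit (h 0) + count n h                 ∎)
  where open ≡-Reasoning

count-rotate : ∀ n f → (∀ k → f (n + k) ≡ f k) → ∀ w → count n (λ k → f (w + k)) ≡ count n f
count-rotate n f periodic zero    = refl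
count-rotate n f periodic (suc w) = begin
  count n (λ k → f (suc w + k)) ≡⟨ count-cong n (λ k _ → cong f (sym (+-suc w k))) ⟩
  count n (λ k → f (w + suc k)) ≡⟨ count-shift n (λ k → f (w + k)) wrap ⟩
  count n (λ k → f (w + k))     ≡⟨ count-rotate n f periodic w ⟩
  count n f                     ∎
  where
  open ≡-Reasoning
  wrap : f (w + n) ≡ f (w + 0)
  wrap = trans (cong f (+-comm w n)) (trans (periodic w) (cong f (sym (+-identityʳ w))))

∣p∣≡count : ∀ {n} (p : Subset n) f → (∀ i → f (toℕ i) ≡ lookup p i) → ∣ p ∣ ≡ count n f
∣p∣≡count []      f agree = refl
∣p∣≡count {suc n} (x ∷ p) f agree = begin
  ∣ x ∷ p ∣                           ≡⟨ ∣x∷p∣ x ⟩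
  bit x + ∣ p ∣                       ≡⟨ cong₂ _+_ (cong bit (sym (agree Fin.zero))) (∣p∣≡count p (λ k → f (suc k)) (λ i → agree (Fin.suc i))) ⟩
  bit (f 0) + count n (λ k → f (suc k)) ≡⟨ count-+ 1 n f ⟨
  count (suc n) f                     ∎
  where
  open ≡-Reasoning
  ∣x∷p∣ : ∀ x → ∣ x ∷ p ∣ ≡ bit x + ∣ p ∣
  ∣x∷p∣ true  = refl
  ∣x∷p∣ false = refl

cdist-≤ : ∀ {m} (i x : Fin m) → toℕ i ≤ toℕ x → cdist m i x ≡ toℕ x ∸ toℕ i
cdist-≤ {m} i x i≤x =
  cong (λ b → if b then toℕ x ∸ toℕ i else (m + toℕ x) ∸ toℕ i) (dec-true (toℕ i ≤? toℕ x) i≤x)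

cdist-> : ∀ {m} (i x : Fin m) → toℕ x < toℕ i → cdist m i x ≡ (m + toℕ x) ∸ toℕ i
cdist-> {m} i x x<i =
  cong (λ b → if b then toℕ x ∸ toℕ i else (m + toℕ x) ∸ toℕ i) (dec-false (toℕ i ≤? toℕ x) (<⇒≱ x<i))

∀∈⇒∣p∣≡n : ∀ {n} (p : Subset n) → (∀ x → x ∈ p) → ∣ p ∣ ≡ n
∀∈⇒∣p∣≡n {n} p ∀∈p = ≤-antisym (∣p∣≤n p) (subst (_≤ ∣ p ∣) (∣⊤∣≡n n) (p⊆q⇒∣p∣≤∣q∣ {p = ⊤} (λ {x} _ → ∀∈p x)))

module _ {m : ℕ} .{{_ : NonZero m}} where

  toℕ-mod : ∀ x → toℕ (x mod m) ≡ x % m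
  toℕ-mod x = toℕ-fromℕ< (m%n<n x m)

  mod-cong : ∀ {x y} → x % m ≡ y % m → x mod m ≡ y mod m
  mod-cong eq = toℕ-injective (trans (toℕ-mod _) (trans eq (sym (toℕ-mod _))))

  toℕ[i]-mod : (i : Fin m) → toℕ i mod m ≡ i
  toℕ[i]-mod i = toℕ-injective (trans (toℕ-mod (toℕ i)) (m<n⇒m%n≡m (toℕ<n i)))

  [m+k]-mod : ∀ k → (m + k) mod m ≡ k mod m
  [m+k]-mod k = mod-cong (trans (cong (_% m) (+-comm m k)) ([m+n]%n≡m%n k m))

  ∣p∣≡count-from : (p : Subset m) (w : ℕ) → ∣ p ∣ ≡ count m (λ k → lookup p ((w + k) mod m))
  ∣p∣≡count-from p w = begin
    ∣ p ∣                                      ≡⟨ ∣p∣≡count p (λ k → lookup p (k mod m)) (λ i → cong (lookup p) (toℕ[i]-mod i)) ⟩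
    count m (λ k → lookup p (k mod m))         ≡⟨ count-rotate m _ (λ k → cong (lookup p) ([m+k]-mod k)) w ⟨
    count m (λ k → lookup p ((w + k) mod m))   ∎
    where open ≡-Reasoning

  cdist-% : (i x : Fin m) {j : ℕ} → j < m → toℕ x ≡ (toℕ i + j) % m → cdist m i x ≡ j
  cdist-% i x {j} j<m x≡ with toℕ i + j <? m
  ... | yes no-wrap = begin
    cdist m i x        ≡⟨ cdist-≤ i x (subst (toℕ i ≤_) (sym x≡i+j) (m≤m+n _ _)) ⟩
    toℕ x ∸ toℕ i      ≡⟨ cong (_∸ toℕ i) x≡i+j ⟩
    toℕ i + j ∸ toℕ i  ≡⟨ m+n∸m≡n (toℕ i) j ⟩
    j                  ∎
    where
    open ≡-Reasoning
    x≡i+j : toℕ x ≡ toℕ i + j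
    x≡i+j = trans x≡ (m<n⇒m%n≡m no-wrap)
  ... | no wrap with m≤n⇒∃[o]m+o≡n (≮⇒≥ wrap)
  ...   | c , m+c≡i+j = begin
    cdist m i x        ≡⟨ cdist-> i x (subst (_< toℕ i) (sym x≡c) c<i) ⟩
    m + toℕ x ∸ toℕ i  ≡⟨ cong (λ y → m + y ∸ toℕ i) x≡c ⟩
    m + c ∸ toℕ i      ≡⟨ cong (_∸ toℕ i) m+c≡i+j ⟩
    toℕ i + j ∸ toℕ i  ≡⟨ m+n∸m≡n (toℕ i) j ⟩
    j                  ∎
    where
    open ≡-Reasoning
    c<m : c < m
    c<m = +-cancelˡ-< m c m (subst (_< m + m) (sym m+c≡i+j) (+-mono-< (toℕ<n i) j<m))
    c<i : c < toℕ i
    c<i = +-cancelˡ-< m c (toℕ i) (subst₂ _<_ (sym m+c≡i+j) (+-comm (toℕ i) m) (+-monoʳ-< (toℕ i) j<m))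
    x≡c : toℕ x ≡ c
    x≡c = begin
      toℕ x           ≡⟨ x≡ ⟩
      (toℕ i + j) % m ≡⟨ cong (_% m) (trans (sym m+c≡i+j) (+-comm m c)) ⟩
      (c + m) % m     ≡⟨ [m+n]%n≡m%n c m ⟩
      c % m           ≡⟨ m<n⇒m%n≡m c<m ⟩
      c               ∎

  cdist-mod : ∀ a {j} → j < m → cdist m (a mod m) ((a + j) mod m) ≡ j
  cdist-mod a {j} j<m = cdist-% (a mod m) ((a + j) mod m) j<m (begin
    toℕ ((a + j) mod m)             ≡⟨ toℕ-mod (a + j) ⟩
    (a + j) % m                     ≡⟨ %-distribˡ-+ a j m ⟩
    (a % m + j % m) % m             ≡⟨ cong₂ (λ x y → (x + y) % m) (sym (toℕ-mod a)) (m<n⇒m%n≡m j<m) ⟩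
    (toℕ (a mod m) + j) % m         ∎)
    where open ≡-Reasoning

  tightEdge-∋ : ∀ {s} a {j} → j < s → j < m → (a + j) mod m ∈ edge (TightCycle s m) (a mod m)
  tightEdge-∋ {s} a {j} j<s j<m = lookup⇒[]= _ _ (begin
    lookup (tabulate (λ y → cdist m (a mod m) y <ᵇ s)) ((a + j) mod m) ≡⟨ lookup∘tabulate _ ((a + j) mod m) ⟩
    cdist m (a mod m) ((a + j) mod m) <ᵇ s                             ≡⟨ cong (_<ᵇ s) (cdist-mod a j<m) ⟩
    j <ᵇ s                                                              ≡⟨ T-≡ .to (<⇒<ᵇ j<s) ⟩
    true                                                                ∎)
    where open ≡-Reasoning

-- Vertex (w + k) mod m, with w = u + 1, is read as position k of a path whose last
-- position m′ is u; an edge of E′ starting at position k then covers k, …, k + s₁.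
missingVertex-bound : ∀ {s₁ m′} {V′ E′ : Subset (suc m′)} → IsSub (TightCycle (suc s₁) (suc m′)) V′ E′ →
  (u : Fin (suc m′)) → u ∉ V′ → 0 < ∣ E′ ∣ → ∣ E′ ∣ + s₁ ≤ ∣ V′ ∣
missingVertex-bound {s₁} {m′} {V′} {E′} sub u u∉V′ 0<∣E′∣ =
  subst₂ (λ e v → e + s₁ ≤ v) (sym (∣p∣≡count-from E′ w)) (sym (∣p∣≡count-from V′ w))
    (count-intervals m s₁ (at E′) (at V′) intervals (subst (0 <_) (∣p∣≡count-from E′ w) 0<∣E′∣))
  where
  m = suc m′
  w = suc (toℕ u)

  at : Subset m → ℕ → Bool
  at p k = lookup p ((w + k) mod m)

  u-at-end : (w + m′) mod m ≡ u
  u-at-end = trans (mod-cong {m} {w + m′} {toℕ u} (trans (cong (_% m) (sym (+-suc (toℕ u) m′))) ([m+n]%n≡m%n (toℕ u) m))) (toℕ[i]-mod u)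

  covered : ∀ k j → (w + k) mod m ∈ E′ → j ≤ s₁ → j < m → (w + (k + j)) mod m ∈ V′
  covered k j k∈E′ j≤s₁ j<m =
    subst (_∈ V′) (cong (_mod m) (+-assoc w k j)) (sub _ k∈E′ (tightEdge-∋ (w + k) (s≤s j≤s₁) j<m))

  before-u : ∀ k j → k < m → (w + k) mod m ∈ E′ → j ≤ s₁ → k + j < m′
  before-u k j k<m k∈E′ j≤s₁ with k + j <? m′
  ... | yes k+j<m′ = k+j<m′
  ... | no k+j≮m′  = contradiction (subst (_∈ V′) u-reached (covered k j′ k∈E′ (≤-trans j′≤j j≤s₁) j′<m)) u∉V′
    where
    j′ = m′ ∸ k
    j′≤j : j′ ≤ j
    j′≤j = subst (j′ ≤_) (m+n∸m≡n k j) (∸-monoˡ-≤ k (≮⇒≥ k+j≮m′))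
    j′<m : j′ < m
    j′<m = s≤s (m∸n≤m m′ k)
    u-reached : (w + (k + j′)) mod m ≡ u
    u-reached = trans (cong (λ y → (w + y) mod m) (m+[n∸m]≡n (≤-pred k<m))) u-at-end

  intervals : ∀ k → k < m → at E′ k ≡ true → ∀ j → j ≤ s₁ → k + j < m × at V′ (k + j) ≡ true
  intervals k k<m Ek j j≤s₁ = m<n⇒m<1+n k+j<m′ , []=⇒lookup (covered k j k∈E′ j≤s₁ j<m)
    where
    k∈E′ : (w + k) mod m ∈ E′
    k∈E′ = lookup⇒[]= _ E′ Ek
    k+j<m′ : k + j < m′
    k+j<m′ = before-u k j k<m k∈E′ j≤s₁
    j<m : j < m
    j<m = ≤-<-trans (m≤n+m j k) (m<n⇒m<1+n k+j<m′)

*≤*⇒/≤/ : ∀ a b c d → a * suc d ≤ c * suc b → ℤ.+ a / suc b ℚ.≤ ℤ.+ c / suc d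
*≤*⇒/≤/ a b c d ad≤cb = ℚ.toℚᵘ-cancel-≤
  (ℚᵘ.≤-respʳ-≃ (ℚᵘ.≃-sym (ℚ.toℚᵘ-fromℚᵘ q)) (ℚᵘ.≤-respˡ-≃ (ℚᵘ.≃-sym (ℚ.toℚᵘ-fromℚᵘ p))
    (ℚᵘ.*≤* (subst₂ ℤ._≤_ (ℤ.pos-* a (suc d)) (ℤ.pos-* c (suc b)) (ℤ.+≤+ ad≤cb)))))
  where
  p = ℚᵘ.mkℚᵘ (ℤ.+ a) b
  q = ℚᵘ.mkℚᵘ (ℤ.+ c) d

/≤1 : ∀ a b → a ≤ suc b → ℤ.+ a / suc b ℚ.≤ 1ℚ
/≤1 a b a≤1+b = *≤*⇒/≤/ a b 1 0 (subst₂ _≤_ (sym (*-identityʳ a)) (sym (*-identityˡ (suc b))) a≤1+b)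

1≤/ : ∀ a b → suc b ≤ a → 1ℚ ℚ.≤ ℤ.+ a / suc b
1≤/ a b 1+b≤a = *≤*⇒/≤/ 1 0 a b (subst₂ _≤_ (sym (*-identityˡ (suc b))) (sym (*-identityʳ a)) 1+b≤a)

g[2+e]≤1 : ∀ s₁ v e → suc e ≤ v ∸ suc s₁ → g (suc s₁) v (suc (suc e)) ℚ.≤ 1ℚ
g[2+e]≤1 s₁ v e 1+e≤v-s with v ∸ suc s₁
... | zero  = contradiction 1+e≤v-s λ ()
... | suc d = /≤1 (suc e) d 1+e≤v-s

g-≤-1 : ∀ s₁ v e → 0 < e → e + s₁ ≤ v → g (suc s₁) v e ℚ.≤ 1ℚ
g-≤-1 s₁ v 1             _ _       = /≤1 1 s₁ (s≤s z≤n)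
g-≤-1 s₁ v (suc (suc e)) _ e+s₁≤v = g[2+e]≤1 s₁ v e (begin
  suc e                              ≡⟨ m+n∸n≡m (suc e) (suc s₁) ⟨
  suc e + suc s₁ ∸ suc s₁            ≡⟨ cong (_∸ suc s₁) (+-suc (suc e) s₁) ⟩
  suc (suc e) + s₁ ∸ suc s₁          ≤⟨ ∸-monoˡ-≤ (suc s₁) e+s₁≤v ⟩
  v ∸ suc s₁                         ∎)
  where open ≤-Reasoning

1≤g-v-v : ∀ s₁ v → suc s₁ < v → 1ℚ ℚ.≤ g (suc s₁) v v
1≤g-v-v s₁ (suc zero)     (s≤s ())
1≤g-v-v s₁ (suc (suc v′)) s<v with suc (suc v′) ∸ suc s₁ in v-s≡
... | zero  = contradiction v-s≡ (m>n⇒m∸n≢0 s<v)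
... | suc d = 1≤/ (suc v′) d (subst (_≤ suc v′) v-s≡ (m∸n≤m (suc v′) s₁))

g[2+e]-mono : ∀ s₁ v {e e′} → e ≤ e′ → g (suc s₁) v (suc (suc e)) ℚ.≤ g (suc s₁) v (suc (suc e′))
g[2+e]-mono s₁ v {e} {e′} e≤e′ with v ∸ suc s₁
... | zero  = ℚ.≤-refl
... | suc d = *≤*⇒/≤/ (suc e) d (suc e′) d (*-monoˡ-≤ (suc d) (s≤s e≤e′))

g-≤-g-v-v : ∀ s₁ v e → 0 < e → e ≤ v → suc s₁ < v → g (suc s₁) v e ℚ.≤ g (suc s₁) v v
g-≤-g-v-v s₁ v              1              _ _   s<v = ℚ.≤-trans (g-≤-1 s₁ v 1 (s≤s z≤n) (<⇒≤ s<v)) (1≤g-v-v s₁ v s<v)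
g-≤-g-v-v s₁ (suc zero)     (suc (suc e′)) _ (s≤s ()) _
g-≤-g-v-v s₁ (suc (suc v′)) (suc (suc e′)) _ e≤v _   = g[2+e]-mono s₁ (suc (suc v′)) (≤-pred (≤-pred e≤v))

tightCycle-edgeBalanced : ∀ s m → 1 ≤ s → s < m → EdgeBalanced s (TightCycle s m)
tightCycle-edgeBalanced (suc s₁) (suc m′) _ s<m V′ E′ sub 0<∣E′∣ with all? (_∈? V′)
... | yes V′-full = subst (λ v → g (suc s₁) v ∣ E′ ∣ ℚ.≤ g (suc s₁) (suc m′) (suc m′)) (sym (∀∈⇒∣p∣≡n V′ V′-full))
                      (g-≤-g-v-v s₁ (suc m′) ∣ E′ ∣ 0<∣E′∣ (∣p∣≤n E′) s<m)
... | no ¬V′-full with ¬∀⟶∃¬ _ _ (_∈? V′) ¬V′-full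
...   | u , u∉V′ = ℚ.≤-trans (g-≤-1 s₁ _ _ 0<∣E′∣ (missingVertex-bound sub u u∉V′ 0<∣E′∣)) (1≤g-v-v s₁ (suc m′) s<m)

claim5 : (s m : ℕ) → 2 ≤ s → suc s ≤ m → EdgeBalanced s (TightCycle s m)
claim5 s m 2≤s = tightCycle-edgeBalanced s m (<⇒≤ 2≤s)
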